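{- Let $B\geq 2$, let $a\geq 0$ be an integer and $|q|<1$. Then $$\sum_{n=1}^{\infty}\widehat{c}_B(\{a\}^n) q^n=\frac{q}{1-q}\sum_{n=0}^{\infty} \widehat{c}_B(an,a)q^n.$$
   Context: For an integer $a\geq 0$, $s_B(a)$ is the sum of its base-$B$ digits ($s_B(0)=0$). For integers $a_1,\dots,a_r\ge 0$ with base-$B$ digits $a_i=\sum_{j\ge0}\alpha_{i,j}B^j$, $0\le\alpha_{i,j}<B$, let $t\ge0$ be the largest $j$ with some $\alpha_{i,j}\ne0$ ($t=0$ if all are zero), define the carries of the traditional base-$B$ column addition algorithm by $\delta_0=\lfloor(\sum_i\alpha_{i,0})/B\rfloor$, $\delta_j=\lfloor(\sum_i\alpha_{i,j}+\delta_{j-1})/B\rfloor$ for $1\le j\le t$, carry sum $c_B(a_1,\dots,a_r)=\sum_{j=0}^t\delta_j$, terminal carry $\beta=\delta_t$, and $\widehat{c}_B(a_1,\dots,a_r):=\beta-s_B(\beta)+(B-1)c_B(a_1,\dots,a_r)$. In particular for two summands $\widehat{c}_B(a,b)=(B-1)c_B(a,b)$. Finally $\widehat{c}_B(\{a\}^n)$ denotes $\widehat{c}_B(a,a,\dots,a)$ with $n$ copies of $a$. -}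

module Defs where

open import Data.Nat using (ℕ; zero; suc; _+_; _*_; _∸_; _^_; _⊔_; NonZero)
open import Data.Nat.DivMod using (_/_; _%_)
open import Data.List using (List; []; _∷_; map; foldr; replicate)
open import Data.Nat.ListAction using (sum)

Σ< : ℕ → (ℕ → ℕ) → ℕ
Σ< zero    f = zero
Σ< (suc n) f = Σ< n f + f n

digit : (B : ℕ) .{{_ : NonZero B}} → ℕ → ℕ → ℕ
digit B zero    a = a % B
digit B (suc j) a = digit B j (a / B)

-- digit sum s_B(a), computed with fuel (fuel = a suffices when B ≥ 2)
sB-fuel : (B : ℕ) .{{_ : NonZero B}} → ℕ → ℕ → ℕ
sB-fuel B zero       a = zero
sB-fuel B (suc fuel) zero = zero
sB-fuel B (suc fuel) a@(suc _) = a % B + sB-fuel B fuel (a / B)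

sB : (B : ℕ) .{{_ : NonZero B}} → ℕ → ℕ
sB B a = sB-fuel B a a

len-fuel : (B : ℕ) .{{_ : NonZero B}} → ℕ → ℕ → ℕ
len-fuel B zero       a = zero
len-fuel B (suc fuel) zero = zero
len-fuel B (suc fuel) a@(suc _) = suc (len-fuel B fuel (a / B))

len : (B : ℕ) .{{_ : NonZero B}} → ℕ → ℕ
len B a = len-fuel B a a

-- t : largest j with some α_{i,j} ≠ 0 (t = 0 if all are zero)
top : (B : ℕ) .{{_ : NonZero B}} → List ℕ → ℕ
top B as = foldr _⊔_ 0 (map (λ a → len B a ∸ 1) as)

colSum : (B : ℕ) .{{_ : NonZero B}} → List ℕ → ℕ → ℕ
colSum B as j = sum (map (digit B j) as)

carry : (B : ℕ) .{{_ : NonZero B}} → List ℕ → ℕ → ℕ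
carry B as zero    = colSum B as 0 / B
carry B as (suc j) = (colSum B as (suc j) + carry B as j) / B

cB : (B : ℕ) .{{_ : NonZero B}} → List ℕ → ℕ
cB B as = Σ< (suc (top B as)) (carry B as)

termCarry : (B : ℕ) .{{_ : NonZero B}} → List ℕ → ℕ
termCarry B as = carry B as (top B as)

-- ĉ_B(a_1,…,a_r) = β − s_B(β) + (B−1) c_B(a_1,…,a_r)   (β − s_B(β) ≥ 0)
ĉB : (B : ℕ) .{{_ : NonZero B}} → List ℕ → ℕ
ĉB B as = (termCarry B as ∸ sB B (termCarry B as)) + (B ∸ 1) * cB B as

ĉB-rep : (B : ℕ) .{{_ : NonZero B}} → ℕ → ℕ → ℕ
ĉB-rep B a n = ĉB B (replicate n a)

-- Formal power series with ℕ coefficients: coefficient sequences ℕ → ℕ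
FPS : Set
FPS = ℕ → ℕ

_⊛_ : FPS → FPS → FPS
(f ⊛ g) n = Σ< (suc n) (λ k → f k * g (n ∸ k))

q/1-q : FPS
q/1-q zero    = 0
q/1-q (suc _) = 1

lhsSeries : (B : ℕ) .{{_ : NonZero B}} → ℕ → FPS
lhsSeries B a zero        = 0
lhsSeries B a n@(suc _)   = ĉB-rep B a n

rhsInner : (B : ℕ) .{{_ : NonZero B}} → ℕ → FPS
rhsInner B a n = ĉB B (a * n ∷ a ∷ [])

module Submission where

open import Defs
open import Data.Nat using (ℕ; zero; suc; _+_; _*_; _∸_; _≤_; z≤n; s≤s; NonZero)
open import Data.Nat.Properties
open import Data.Nat.DivMod
open import Data.Nat.Divisibility using (divides-refl)
open import Data.Nat.ListAction using (sum)
open import Data.Nat.Tactic.RingSolver using (solve-∀)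
open import Data.List using (List; []; _∷_; map; replicate)
open import Data.List.Properties using (map-id; map-replicate)
open import Data.Product using (_×_; _,_)
open import Relation.Binary.PropositionalEquality

-- Adding a₁,…,a_r column by column, every carry δ turns B units of one column into
-- one unit of the next, lowering the total digit sum by B − 1; the terminal carry β
-- is written as one digit although its true digit sum is s_B(β).  Hence
--   ĉ_B(a₁,…,a_r) + s_B(a₁ + ⋯ + a_r) = s_B(a₁) + ⋯ + s_B(a_r).
-- So ĉ_B({a}ⁿ) = n s_B(a) − s_B(an) and ĉ_B(am, a) = s_B(am) + s_B(a) − s_B(a(m+1)),
-- which telescopes to ĉ_B({a}ⁿ) = Σ_{m<n} ĉ_B(am, a): the coefficient identity
-- behind multiplying by q/(1 − q).

Σ<-cong : ∀ n {f g : ℕ → ℕ} → (∀ k → f k ≡ g k) → Σ< n f ≡ Σ< n g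
Σ<-cong zero    f≗g = refl
Σ<-cong (suc n) f≗g = cong₂ _+_ (Σ<-cong n f≗g) (f≗g n)

Σ<-head : ∀ n (f : ℕ → ℕ) → Σ< (suc n) f ≡ f 0 + Σ< n (λ k → f (suc k))
Σ<-head zero    f = +-comm 0 (f 0)
Σ<-head (suc n) f = trans (cong (_+ f (suc n)) (Σ<-head n f)) (+-assoc (f 0) _ _)

Σ<-reverse : ∀ n (f : ℕ → ℕ) → Σ< (suc n) (λ k → f (n ∸ k)) ≡ Σ< (suc n) f
Σ<-reverse zero    f = refl
Σ<-reverse (suc n) f = begin
    Σ< (suc (suc n)) (λ k → f (suc n ∸ k))
  ≡⟨ Σ<-head (suc n) (λ k → f (suc n ∸ k)) ⟩
    f (suc n) + Σ< (suc n) (λ k → f (n ∸ k))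
  ≡⟨ cong (f (suc n) +_) (Σ<-reverse n f) ⟩
    f (suc n) + Σ< (suc n) f
  ≡⟨ +-comm (f (suc n)) _ ⟩
    Σ< (suc (suc n)) f ∎
  where open ≡-Reasoning

q/1-q-⊛ : ∀ (f : FPS) n → (q/1-q ⊛ f) (suc n) ≡ Σ< (suc n) f
q/1-q-⊛ f n = begin
    Σ< (suc (suc n)) (λ k → q/1-q k * f (suc n ∸ k))
  ≡⟨ Σ<-head (suc n) (λ k → q/1-q k * f (suc n ∸ k)) ⟩
    Σ< (suc n) (λ k → 1 * f (n ∸ k))
  ≡⟨ Σ<-cong (suc n) (λ k → *-identityˡ (f (n ∸ k))) ⟩
    Σ< (suc n) (λ k → f (n ∸ k))
  ≡⟨ Σ<-reverse n f ⟩
    Σ< (suc n) f ∎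
  where open ≡-Reasoning

sum-replicate : ∀ n x → sum (replicate n x) ≡ n * x
sum-replicate zero    x = refl
sum-replicate (suc n) x = cong (x +_) (sum-replicate n x)

module Radix (b : ℕ) where

  B : ℕ
  B = 2 + b

  1+n/B≤n : ∀ n → suc n / B ≤ n
  1+n/B≤n n = ≤-pred (m/n<m (suc n) B (s≤s (s≤s z≤n)))

  dropDigits : ℕ → ℕ → ℕ
  dropDigits zero    x = x
  dropDigits (suc j) x = dropDigits j (x / B)

  digit≡dropDigits%B : ∀ j x → digit B j x ≡ dropDigits j x % B
  digit≡dropDigits%B zero    x = refl
  digit≡dropDigits%B (suc j) x = digit≡dropDigits%B j (x / B)

  dropDigits-suc : ∀ j x → dropDigits (suc j) x ≡ dropDigits j x / B
  dropDigits-suc zero    x = refl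
  dropDigits-suc (suc j) x = dropDigits-suc j (x / B)

  dropDigits-+ : ∀ j k x → dropDigits (j + k) x ≡ dropDigits k (dropDigits j x)
  dropDigits-+ zero    k x = refl
  dropDigits-+ (suc j) k x = dropDigits-+ j k (x / B)

  dropDigits-zero : ∀ j → dropDigits j 0 ≡ 0
  dropDigits-zero zero    = refl
  dropDigits-zero (suc j) = dropDigits-zero j

  dropDigits-len-fuel : ∀ f x → x ≤ f → dropDigits (len-fuel B f x) x ≡ 0
  dropDigits-len-fuel zero    zero    _ = refl
  dropDigits-len-fuel (suc f) zero    _ = refl
  dropDigits-len-fuel (suc f) (suc n) (s≤s n≤f) =
    dropDigits-len-fuel f (suc n / B) (≤-trans (1+n/B≤n n) n≤f)

  dropDigits-≥len : ∀ {j} x → len B x ≤ j → dropDigits j x ≡ 0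
  dropDigits-≥len {j} x len≤j = begin
      dropDigits j x
    ≡⟨ cong (λ i → dropDigits i x) (sym (m+[n∸m]≡n len≤j)) ⟩
      dropDigits (len B x + (j ∸ len B x)) x
    ≡⟨ dropDigits-+ (len B x) (j ∸ len B x) x ⟩
      dropDigits (j ∸ len B x) (dropDigits (len B x) x)
    ≡⟨ cong (dropDigits (j ∸ len B x)) (dropDigits-len-fuel x x ≤-refl) ⟩
      dropDigits (j ∸ len B x) 0
    ≡⟨ dropDigits-zero (j ∸ len B x) ⟩
      0 ∎
    where open ≡-Reasoning

  sB-fuel-zero : ∀ f → sB-fuel B f 0 ≡ 0
  sB-fuel-zero zero    = refl
  sB-fuel-zero (suc f) = refl

  sB-fuel-irrelevant : ∀ f g x → x ≤ f → x ≤ g → sB-fuel B f x ≡ sB-fuel B g x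
  sB-fuel-irrelevant f       g       zero    _         _         =
    trans (sB-fuel-zero f) (sym (sB-fuel-zero g))
  sB-fuel-irrelevant (suc f) (suc g) (suc n) (s≤s n≤f) (s≤s n≤g) =
    cong (suc n % B +_) (sB-fuel-irrelevant f g (suc n / B)
      (≤-trans (1+n/B≤n n) n≤f) (≤-trans (1+n/B≤n n) n≤g))

  sB-step : ∀ x → sB B x ≡ x % B + sB B (x / B)
  sB-step zero    = refl
  sB-step (suc n) = cong (suc n % B +_) (sB-fuel-irrelevant n (suc n / B) (suc n / B) (1+n/B≤n n) ≤-refl)

  sB-dropDigits : ∀ j x → sB B (dropDigits j x) ≡ dropDigits j x % B + sB B (dropDigits (suc j) x)
  sB-dropDigits j x = trans (sB-step (dropDigits j x)) (cong (λ y → dropDigits j x % B + sB B y) (sym (dropDigits-suc j x)))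

  sB-fuel-≤ : ∀ f x → sB-fuel B f x ≤ x
  sB-fuel-≤ zero    x       = z≤n
  sB-fuel-≤ (suc f) zero    = z≤n
  sB-fuel-≤ (suc f) (suc n) = begin
      suc n % B + sB-fuel B f (suc n / B)
    ≤⟨ +-monoʳ-≤ (suc n % B) (sB-fuel-≤ f (suc n / B)) ⟩
      suc n % B + suc n / B
    ≤⟨ +-monoʳ-≤ (suc n % B) (m≤m*n (suc n / B) B) ⟩
      suc n % B + suc n / B * B
    ≡⟨ sym (m≡m%n+[m/n]*n (suc n) B) ⟩
      suc n ∎
    where open ≤-Reasoning

  sB≤id : ∀ x → sB B x ≤ x
  sB≤id x = sB-fuel-≤ x x

  high : ℕ → List ℕ → ℕ
  high j as = sum (map (dropDigits j) as)

  highDigitSum : ℕ → List ℕ → ℕ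
  highDigitSum j as = sum (map (λ x → sB B (dropDigits j x)) as)

  high-split : ∀ j as → high j as ≡ colSum B as j + high (suc j) as * B
  high-split j []       = refl
  high-split j (x ∷ as) = begin
      dropDigits j x + high j as
    ≡⟨ cong₂ _+_ (m≡m%n+[m/n]*n (dropDigits j x) B) (high-split j as) ⟩
      (dropDigits j x % B + dropDigits j x / B * B) + (colSum B as j + high (suc j) as * B)
    ≡⟨ interchange (dropDigits j x % B) (dropDigits j x / B) (colSum B as j) (high (suc j) as) B ⟩
      (dropDigits j x % B + colSum B as j) + (dropDigits j x / B + high (suc j) as) * B
    ≡⟨ cong₂ (λ u v → (u + colSum B as j) + (v + high (suc j) as) * B)
         (sym (digit≡dropDigits%B j x)) (sym (dropDigits-suc j x)) ⟩
      (digit B j x + colSum B as j) + (dropDigits (suc j) x + high (suc j) as) * B ∎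
    where
    open ≡-Reasoning
    interchange : ∀ r q c h m → (r + q * m) + (c + h * m) ≡ (r + c) + (q + h) * m
    interchange = solve-∀

  highDigitSum-split : ∀ j as → highDigitSum j as ≡ colSum B as j + highDigitSum (suc j) as
  highDigitSum-split j []       = refl
  highDigitSum-split j (x ∷ as) = begin
      sB B (dropDigits j x) + highDigitSum j as
    ≡⟨ cong₂ _+_ (sB-dropDigits j x) (highDigitSum-split j as) ⟩
      (dropDigits j x % B + sB B (dropDigits (suc j) x)) + (colSum B as j + highDigitSum (suc j) as)
    ≡⟨ cong (λ d → (d + sB B (dropDigits (suc j) x)) + (colSum B as j + highDigitSum (suc j) as))
         (sym (digit≡dropDigits%B j x)) ⟩
      (digit B j x + sB B (dropDigits (suc j) x)) + (colSum B as j + highDigitSum (suc j) as)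
    ≡⟨ interchange (digit B j x) _ (colSum B as j) _ ⟩
      (digit B j x + colSum B as j) + (sB B (dropDigits (suc j) x) + highDigitSum (suc j) as) ∎
    where
    open ≡-Reasoning
    interchange : ∀ p q r s → (p + q) + (r + s) ≡ (p + r) + (q + s)
    interchange = solve-∀

  beyond-top : ∀ as t → top B as ≤ t → (high (suc t) as ≡ 0) × (highDigitSum (suc t) as ≡ 0)
  beyond-top []       t _      = refl , refl
  beyond-top (x ∷ as) t top≤t with beyond-top as t (m⊔n≤o⇒n≤o (len B x ∸ 1) _ top≤t)
  ... | high≡0 , highDigitSum≡0 =
    cong₂ _+_ x-vanishes high≡0 , cong₂ _+_ (cong (sB B) x-vanishes) highDigitSum≡0
    where
    x-vanishes : dropDigits (suc t) x ≡ 0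
    x-vanishes = dropDigits-≥len x (≤-trans (m≤n+m∸n (len B x) 1) (s≤s (m⊔n≤o⇒m≤o (len B x ∸ 1) _ top≤t)))

  module ColumnAddition (as : List ℕ) where

    col : ℕ → ℕ
    col = colSum B as

    incoming : ℕ → ℕ
    incoming zero    = 0
    incoming (suc j) = carry B as j

    carry≡ : ∀ j → carry B as j ≡ (col j + incoming j) / B
    carry≡ zero    = cong (_/ B) (sym (+-identityʳ (col 0)))
    carry≡ (suc j) = refl

    dropDigits-sum : ∀ j → dropDigits j (sum as) ≡ high j as + incoming j

    dropDigits-sum-split : ∀ j → dropDigits j (sum as) ≡ (col j + incoming j) + high (suc j) as * B
    dropDigits-sum-split j = begin
        dropDigits j (sum as)
      ≡⟨ dropDigits-sum j ⟩
        high j as + incoming j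
      ≡⟨ cong (_+ incoming j) (high-split j as) ⟩
        col j + high (suc j) as * B + incoming j
      ≡⟨ swap (col j) (high (suc j) as * B) (incoming j) ⟩
        (col j + incoming j) + high (suc j) as * B ∎
      where
      open ≡-Reasoning
      swap : ∀ x y z → x + y + z ≡ x + z + y
      swap = solve-∀

    dropDigits-sum zero    = trans (cong sum (sym (map-id as))) (sym (+-identityʳ _))
    dropDigits-sum (suc j) = begin
        dropDigits (suc j) (sum as)
      ≡⟨ dropDigits-suc j (sum as) ⟩
        dropDigits j (sum as) / B
      ≡⟨ cong (_/ B) (dropDigits-sum-split j) ⟩
        ((col j + incoming j) + high (suc j) as * B) / B
      ≡⟨ +-distrib-/-∣ʳ (col j + incoming j) (divides-refl (high (suc j) as)) ⟩
        (col j + incoming j) / B + high (suc j) as * B / B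
      ≡⟨ cong₂ _+_ (sym (carry≡ j)) (m*n/n≡m (high (suc j) as) B) ⟩
        carry B as j + high (suc j) as
      ≡⟨ +-comm (carry B as j) _ ⟩
        high (suc j) as + incoming (suc j) ∎
      where open ≡-Reasoning

    column-equation : ∀ j → col j + incoming j ≡ dropDigits j (sum as) % B + carry B as j * B
    column-equation j = begin
        col j + incoming j
      ≡⟨ m≡m%n+[m/n]*n (col j + incoming j) B ⟩
        (col j + incoming j) % B + (col j + incoming j) / B * B
      ≡⟨ cong₂ (λ r c → r + c * B) (sym sameDigit) (sym (carry≡ j)) ⟩
        dropDigits j (sum as) % B + carry B as j * B ∎
      where
      open ≡-Reasoning
      sameDigit : dropDigits j (sum as) % B ≡ (col j + incoming j) % B
      sameDigit = trans (cong (_% B) (dropDigits-sum-split j)) ([m+kn]%n≡m%n (col j + incoming j) (high (suc j) as) B)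

    digitSums-invariant : ∀ j →
      sum (map (sB B) as) + sB B (dropDigits j (sum as))
        ≡ sB B (sum as) + suc b * Σ< j (carry B as) + incoming j + highDigitSum j as
    digitSums-invariant zero = begin
        sum (map (sB B) as) + sB B (sum as)
      ≡⟨ +-comm (sum (map (sB B) as)) _ ⟩
        sB B (sum as) + sum (map (sB B) as)
      ≡⟨ cong (_+ sum (map (sB B) as)) (sym noCarriesYet) ⟩
        sB B (sum as) + suc b * 0 + 0 + highDigitSum 0 as ∎
      where
      open ≡-Reasoning
      noCarriesYet : sB B (sum as) + suc b * 0 + 0 ≡ sB B (sum as)
      noCarriesYet = trans (+-identityʳ _) (trans (cong (sB B (sum as) +_) (*-zeroʳ (suc b))) (+-identityʳ _))
    digitSums-invariant (suc j) = +-cancelˡ-≡ r _ _ (begin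
        r + (SS + sB B (dropDigits (suc j) (sum as)))
      ≡⟨ rotate r SS _ ⟩
        SS + (r + sB B (dropDigits (suc j) (sum as)))
      ≡⟨ cong (SS +_) (sym (sB-dropDigits j (sum as))) ⟩
        SS + sB B (dropDigits j (sum as))
      ≡⟨ digitSums-invariant j ⟩
        X + incoming j + highDigitSum j as
      ≡⟨ cong (X + incoming j +_) (highDigitSum-split j as) ⟩
        X + incoming j + (col j + highDigitSum (suc j) as)
      ≡⟨ regroup X (incoming j) (col j) _ ⟩
        X + (col j + incoming j) + highDigitSum (suc j) as
      ≡⟨ cong (λ u → X + u + highDigitSum (suc j) as) (column-equation j) ⟩
        X + (r + δ * B) + highDigitSum (suc j) as
      ≡⟨ payCarry r (sB B (sum as)) b (Σ< j (carry B as)) δ _ ⟩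
        r + (sB B (sum as) + suc b * (Σ< j (carry B as) + δ) + δ + highDigitSum (suc j) as) ∎)
      where
      open ≡-Reasoning
      SS = sum (map (sB B) as)
      δ  = carry B as j
      r  = dropDigits j (sum as) % B
      X  = sB B (sum as) + suc b * Σ< j (carry B as)
      rotate : ∀ x y z → x + (y + z) ≡ y + (x + z)
      rotate = solve-∀
      regroup : ∀ x i c h → x + i + (c + h) ≡ x + (c + i) + h
      regroup = solve-∀
      payCarry : ∀ r s b c d h → s + suc b * c + (r + d * suc (suc b)) + h
                                  ≡ r + (s + suc b * (c + d) + d + h)
      payCarry = solve-∀

  ĉB+sB-sum : ∀ as → ĉB B as + sB B (sum as) ≡ sum (map (sB B) as)
  ĉB+sB-sum as with beyond-top as (top B as) ≤-refl
  ... | high≡0 , highDigitSum≡0 = +-cancelʳ-≡ sβ _ _ (begin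
      (β ∸ sβ) + suc b * c + s + sβ
    ≡⟨ rearrange (β ∸ sβ) (suc b * c) s sβ ⟩
      s + suc b * c + ((β ∸ sβ) + sβ)
    ≡⟨ cong (s + suc b * c +_) (m∸n+n≡m (sB≤id β)) ⟩
      s + suc b * c + β
    ≡⟨ sym (trans (cong (s + suc b * c + β +_) highDigitSum≡0) (+-identityʳ _)) ⟩
      s + suc b * c + β + highDigitSum (suc (top B as)) as
    ≡⟨ sym (digitSums-invariant (suc (top B as))) ⟩
      sum (map (sB B) as) + sB B (dropDigits (suc (top B as)) (sum as))
    ≡⟨ cong (λ y → sum (map (sB B) as) + sB B y) (trans (dropDigits-sum (suc (top B as))) (cong (_+ β) high≡0)) ⟩
      sum (map (sB B) as) + sβ ∎)
    where
    open ≡-Reasoning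
    open ColumnAddition as
    β  = termCarry B as
    sβ = sB B β
    c  = cB B as
    s  = sB B (sum as)
    rearrange : ∀ d e f g → d + e + f + g ≡ f + e + (d + g)
    rearrange = solve-∀

  ĉB-replicate+sB : ∀ a n → ĉB B (replicate n a) + sB B (a * n) ≡ n * sB B a
  ĉB-replicate+sB a n = begin
      ĉB B (replicate n a) + sB B (a * n)
    ≡⟨ cong (λ y → ĉB B (replicate n a) + sB B y) (trans (*-comm a n) (sym (sum-replicate n a))) ⟩
      ĉB B (replicate n a) + sB B (sum (replicate n a))
    ≡⟨ ĉB+sB-sum (replicate n a) ⟩
      sum (map (sB B) (replicate n a))
    ≡⟨ cong sum (map-replicate (sB B) n a) ⟩
      sum (replicate n (sB B a))
    ≡⟨ sum-replicate n (sB B a) ⟩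
      n * sB B a ∎
    where open ≡-Reasoning

  ĉB-pair+sB : ∀ a m → ĉB B (a * m ∷ a ∷ []) + sB B (a * suc m) ≡ sB B (a * m) + sB B a
  ĉB-pair+sB a m = begin
      ĉB B (a * m ∷ a ∷ []) + sB B (a * suc m)
    ≡⟨ cong (λ y → ĉB B (a * m ∷ a ∷ []) + sB B y) (trans (*-suc a m) (trans (+-comm a (a * m)) (cong (a * m +_) (sym (+-identityʳ a))))) ⟩
      ĉB B (a * m ∷ a ∷ []) + sB B (a * m + (a + 0))
    ≡⟨ ĉB+sB-sum (a * m ∷ a ∷ []) ⟩
      sB B (a * m) + (sB B a + 0)
    ≡⟨ cong (sB B (a * m) +_) (+-identityʳ (sB B a)) ⟩
      sB B (a * m) + sB B a ∎
    where open ≡-Reasoning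

  Σ<-ĉB-pair+sB : ∀ a n → Σ< n (λ m → ĉB B (a * m ∷ a ∷ [])) + sB B (a * n) ≡ n * sB B a
  Σ<-ĉB-pair+sB a zero    = cong (sB B) (*-zeroʳ a)
  Σ<-ĉB-pair+sB a (suc n) = begin
      (Σ + ĉB B (a * n ∷ a ∷ [])) + sB B (a * suc n)
    ≡⟨ +-assoc Σ _ _ ⟩
      Σ + (ĉB B (a * n ∷ a ∷ []) + sB B (a * suc n))
    ≡⟨ cong (Σ +_) (ĉB-pair+sB a n) ⟩
      Σ + (sB B (a * n) + sB B a)
    ≡⟨ sym (+-assoc Σ _ _) ⟩
      (Σ + sB B (a * n)) + sB B a
    ≡⟨ cong (_+ sB B a) (Σ<-ĉB-pair+sB a n) ⟩
      n * sB B a + sB B a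
    ≡⟨ +-comm (n * sB B a) (sB B a) ⟩
      suc n * sB B a ∎
    where
    open ≡-Reasoning
    Σ = Σ< n (λ m → ĉB B (a * m ∷ a ∷ []))

  ĉB-replicate≡Σ<-ĉB-pair : ∀ a n → ĉB B (replicate n a) ≡ Σ< n (λ m → ĉB B (a * m ∷ a ∷ []))
  ĉB-replicate≡Σ<-ĉB-pair a n = +-cancelʳ-≡ (sB B (a * n)) _ _
    (trans (ĉB-replicate+sB a n) (sym (Σ<-ĉB-pair+sB a n)))

theorem2p8 : (B : ℕ) .{{_ : NonZero B}} → 2 ≤ B → (a : ℕ) →
    (N : ℕ) → lhsSeries B a N ≡ (q/1-q ⊛ rhsInner B a) N
theorem2p8 (suc (suc b)) (s≤s (s≤s z≤n)) a zero    = refl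
theorem2p8 (suc (suc b)) (s≤s (s≤s z≤n)) a (suc n) =
  trans (Radix.ĉB-replicate≡Σ<-ĉB-pair b a (suc n)) (sym (q/1-q-⊛ (rhsInner (suc (suc b)) a) n))
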